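{- Let $s,t\ge0$, $a,b\ge1$ be integers, let $B$ be the solution of $B(n)=B(n-s-B(n-a))+B(n-t-B(n-b))$ with initial values $\xi_1,\dots,\xi_c$, and suppose $B$ is slowly growing. Let $m$ be a positive integer and let $\alpha_1,\dots,\alpha_m$ and $\beta_1,\dots,\beta_m$ be integers with $i-m\le\alpha_i<i$ and $i-m\le\beta_i<i$ for all $1\le i\le m$. If the sequence $C$ defined by $$C(n)=C\Big(n-ms-\sum_{i=1}^m C(n-ma+\alpha_i)\Big)+C\Big(n-mt-\sum_{i=1}^m C(n-mb+\beta_i)\Big)\qquad(n>mc),$$ with initial conditions $\xi_1,\dots,\xi_1,\dots,\xi_c,\dots,\xi_c$ (each $\xi_i$ repeated $m$ times), is well defined, then $C$ is the $m$-interleaving of $B$.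
   Context: A sequence is slowly growing if its successive differences are all $0$ or $1$ and it tends to infinity. The $m$-interleaving of a sequence $b_1,b_2,\dots$ is the sequence in which each term is repeated $m$ times consecutively, i.e. the sequence $A$ with $A(mn-j)=b_n$ for $0\le j<m$. -}

module Defs where

open import Data.Nat as ℕ using (ℕ; zero; suc)
open import Data.Integer using (ℤ; +_; _+_; _-_; _*_; _≤_; _<_; ∣_∣)
open import Data.Product using (_×_; ∃-syntax)
open import Data.Sum using (_⊎_)
open import Relation.Binary.PropositionalEquality using (_≡_)

-- A (partial) recurrence may only look up positions 1 ≤ k < n when computing term n.
ValidIx : ℕ → ℤ → Set
ValidIx n k = (+ 1 ≤ k) × (k < + n)

_at_ : (ℕ → ℤ) → ℤ → ℤ
f at k = f ∣ k ∣

sum1 : ℕ → (ℕ → ℤ) → ℤ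
sum1 zero    g = + 0
sum1 (suc m) g = sum1 m g + g (suc m)

IsSolB : ℕ → ℕ → ℕ → ℕ → ℕ → (ℕ → ℤ) → (ℕ → ℤ) → Set
IsSolB s t a b c ξ B =
  (∀ i → 1 ℕ.≤ i → i ℕ.≤ c → B i ≡ ξ i) ×
  (∀ n → c ℕ.< n →
     ValidIx n (+ n - + a) ×
     ValidIx n (+ n - + s - B at (+ n - + a)) ×
     ValidIx n (+ n - + b) ×
     ValidIx n (+ n - + t - B at (+ n - + b)) ×
     (B n ≡ B at (+ n - + s - B at (+ n - + a))
          + B at (+ n - + t - B at (+ n - + b))))

IsSolC : ℕ → ℕ → ℕ → ℕ → ℕ → ℕ → (ℕ → ℤ) → (ℕ → ℤ) → (ℕ → ℤ) → (ℕ → ℤ) → Set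
IsSolC m s t a b c α β ξ C =
  (∀ k j → 1 ℕ.≤ k → k ℕ.≤ c → j ℕ.< m → C (m ℕ.* k ℕ.∸ j) ≡ ξ k) ×
  (∀ n → m ℕ.* c ℕ.< n →
     (∀ i → 1 ℕ.≤ i → i ℕ.≤ m → ValidIx n (+ n - + (m ℕ.* a) + α i)) ×
     ValidIx n (+ n - + (m ℕ.* s) - SA n) ×
     (∀ i → 1 ℕ.≤ i → i ℕ.≤ m → ValidIx n (+ n - + (m ℕ.* b) + β i)) ×
     ValidIx n (+ n - + (m ℕ.* t) - SB n) ×
     (C n ≡ C at (+ n - + (m ℕ.* s) - SA n) + C at (+ n - + (m ℕ.* t) - SB n)))
  where
  SA SB : ℕ → ℤ
  SA n = sum1 m (λ i → C at (+ n - + (m ℕ.* a) + α i))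
  SB n = sum1 m (λ i → C at (+ n - + (m ℕ.* b) + β i))

SlowlyGrowing : (ℕ → ℤ) → Set
SlowlyGrowing B =
  (∀ n → 1 ℕ.≤ n → (B (suc n) ≡ B n) ⊎ (B (suc n) ≡ B n + + 1)) ×
  (∀ (M : ℤ) → ∃[ N ] ∀ n → N ℕ.≤ n → M ≤ B n)

Interleaving : ℕ → (ℕ → ℤ) → (ℕ → ℤ) → Set
Interleaving m b A = ∀ n j → 1 ℕ.≤ n → j ℕ.< m → A (m ℕ.* n ℕ.∸ j) ≡ b n

module Submission where

-- Write every position as p = mK - j with K ≥ 1 and 0 ≤ j < m
-- ("p lies in block K"); the claim is C(p) = B(K).  We prove it by strong
-- induction on p.  Inside the initial segment this is the choice of initial
-- values.  Beyond it, write n = mK - j.  Since i - m ≤ αᵢ < i, the index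
-- n - ma + αᵢ lies in block K - a or in a neighbouring block, and because B is
-- slowly growing (monotone, steps of size ≤ 1) the induction hypothesis pins
-- the summand C(n - ma + αᵢ) between V - [i ≤ j] and V + [i > j + 1], where
-- V = B(K - a).  Summing over i gives mV - j ≤ S ≤ mV + m - j - 1 for the inner
-- sum S, which says exactly that n - ms - S lies in block K - s - V; hence
-- C(n - ms - S) = B(K - s - V), and likewise for the second term, so the two
-- recurrences agree at n.

open import Defs
open import Data.Nat using (ℕ; _≤_; _<_; zero; suc; z≤n; s≤s; NonZero)
open import Data.Product using (_×_; _,_; proj₁; proj₂; ∃-syntax)
open import Data.Integer using (ℤ; +_; _-_) renaming (_≤_ to _≤ℤ_; _<_ to _<ℤ_)

import Data.Nat as ℕ
import Data.Nat.Properties as ℕP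
open import Data.Nat.DivMod using (_/_; _%_; m≡m%n+[m/n]*n; m%n<n)
open import Data.Nat.Induction using (<-rec)
open import Data.Integer using (_+_; _*_; -_; ∣_∣; +≤+; +<+; 0ℤ; 1ℤ; -1ℤ)
import Data.Integer.Properties as ℤP
open import Data.Integer.Tactic.RingSolver using (solve-∀)
import Data.Nat.Tactic.RingSolver as ℕSolver
open import Data.Sum using (_⊎_; inj₁; inj₂)
open import Relation.Binary.PropositionalEquality
open import Relation.Nullary using (yes; no)

valid⇒ℕ : ∀ {n x} → ValidIx n x → + ∣ x ∣ ≡ x × 1 ≤ ∣ x ∣ × ∣ x ∣ < n
valid⇒ℕ {n} {x} (1≤x , x<n) =
  x≡ , ℤP.drop‿+≤+ (subst (+ 1 ≤ℤ_) (sym x≡) 1≤x) , ℤP.drop‿+<+ (subst (_<ℤ + n) (sym x≡) x<n)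
  where
  x≡ : + ∣ x ∣ ≡ x
  x≡ = ℤP.0≤i⇒+∣i∣≡i (ℤP.≤-trans (+≤+ z≤n) 1≤x)

≤-suc⇒pred-≤ : ∀ {x y} → x ≤ℤ y + 1ℤ → x - 1ℤ ≤ℤ y
≤-suc⇒pred-≤ {x} {y} x≤y+1 = subst (x - 1ℤ ≤ℤ_) (cancel y) (ℤP.+-monoˡ-≤ (- 1ℤ) x≤y+1)
  where
  cancel : ∀ y → y + 1ℤ - 1ℤ ≡ y
  cancel = solve-∀

sum1-mono : ∀ m {g h : ℕ → ℤ} → (∀ i → 1 ≤ i → i ≤ m → g i ≤ℤ h i) → sum1 m g ≤ℤ sum1 m h
sum1-mono zero    g≤h = ℤP.≤-refl
sum1-mono (suc m) g≤h =
  ℤP.+-mono-≤ (sum1-mono m (λ i 1≤i i≤m → g≤h i 1≤i (ℕP.m≤n⇒m≤1+n i≤m))) (g≤h (suc m) (s≤s z≤n) ℕP.≤-refl)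

stepDown : ℤ → ℕ → ℕ → ℤ
stepDown V j i with i ℕ.≤? j
... | yes _ = V - 1ℤ
... | no  _ = V

sum1-stepDown : ∀ V j m → sum1 m (stepDown V j) ≡ + m * V - + (m ℕ.⊓ j)
sum1-stepDown V j zero = refl
sum1-stepDown V j (suc m) with suc m ℕ.≤? j
... | yes m<j = begin
  sum1 m (stepDown V j) + (V - 1ℤ)  ≡⟨ cong (_+ (V - 1ℤ)) (sum1-stepDown V j m) ⟩
  + m * V - + (m ℕ.⊓ j) + (V - 1ℤ)  ≡⟨ cong (λ k → + m * V - + k + (V - 1ℤ)) (ℕP.m≤n⇒m⊓n≡m (ℕP.<⇒≤ m<j)) ⟩
  + m * V - + m + (V - 1ℤ)          ≡⟨ grow (+ m) V ⟩
  + suc m * V - + suc m             ≡⟨ cong (λ k → + suc m * V - + k) (sym (ℕP.m≤n⇒m⊓n≡m m<j)) ⟩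
  + suc m * V - + (suc m ℕ.⊓ j)     ∎
  where
  open ≡-Reasoning
  grow : ∀ M V → M * V - M + (V - 1ℤ) ≡ (1ℤ + M) * V - (1ℤ + M)
  grow = solve-∀
... | no m≮j = begin
  sum1 m (stepDown V j) + V     ≡⟨ cong (_+ V) (sum1-stepDown V j m) ⟩
  + m * V - + (m ℕ.⊓ j) + V     ≡⟨ cong (λ k → + m * V - + k + V) (ℕP.m≥n⇒m⊓n≡n j≤m) ⟩
  + m * V - + j + V             ≡⟨ grow (+ m) V (+ j) ⟩
  + suc m * V - + j             ≡⟨ cong (λ k → + suc m * V - + k) (sym (ℕP.m≥n⇒m⊓n≡n (ℕP.m≤n⇒m≤1+n j≤m))) ⟩
  + suc m * V - + (suc m ℕ.⊓ j) ∎
  where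
  open ≡-Reasoning
  j≤m : j ≤ m
  j≤m = ℕP.≤-pred (ℕP.≰⇒> m≮j)
  grow : ∀ M V J → M * V - J + V ≡ (1ℤ + M) * V - J
  grow = solve-∀

sum1-between : ∀ m {g : ℕ → ℤ} V {j} → j < m →
  (∀ i → 1 ≤ i → i ≤ m → stepDown V j i ≤ℤ g i × g i ≤ℤ stepDown (V + 1ℤ) (suc j) i) →
  + m * V - + j ≤ℤ sum1 m g × sum1 m g ≤ℤ + m * (V + 1ℤ) - + suc j
sum1-between m {g} V {j} j<m g-bounds =
  subst (_≤ℤ sum1 m g) lower-sum (sum1-mono m (λ i 1≤i i≤m → proj₁ (g-bounds i 1≤i i≤m))) ,
  subst (sum1 m g ≤ℤ_) upper-sum (sum1-mono m (λ i 1≤i i≤m → proj₂ (g-bounds i 1≤i i≤m)))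
  where
  lower-sum : sum1 m (stepDown V j) ≡ + m * V - + j
  lower-sum = trans (sum1-stepDown V j m) (cong (λ t → + m * V - + t) (ℕP.m≥n⇒m⊓n≡n (ℕP.<⇒≤ j<m)))
  upper-sum : sum1 m (stepDown (V + 1ℤ) (suc j)) ≡ + m * (V + 1ℤ) - + suc j
  upper-sum = trans (sum1-stepDown (V + 1ℤ) (suc j) m) (cong (λ t → + m * (V + 1ℤ) - + t) (ℕP.m≥n⇒m⊓n≡n j<m))

module SlowGrowth (B : ℕ → ℤ) (steps : ∀ n → 1 ≤ n → (B (suc n) ≡ B n) ⊎ (B (suc n) ≡ B n + + 1)) where

  B-increment : ∀ d x → 1 ≤ x → B x ≤ℤ B (d ℕ.+ x) × B (d ℕ.+ x) ≤ℤ B x + + d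
  B-increment zero    x _   = ℤP.≤-refl , ℤP.≤-reflexive (sym (ℤP.+-identityʳ (B x)))
  B-increment (suc d) x 1≤x with B-increment d x 1≤x | steps (d ℕ.+ x) (ℕP.≤-trans 1≤x (ℕP.m≤n+m x d))
  ... | lo , hi | inj₁ same =
    subst (B x ≤ℤ_) (sym same) lo ,
    subst (_≤ℤ B x + + suc d) (sym same) (ℤP.≤-trans hi (ℤP.+-monoʳ-≤ (B x) (+≤+ (ℕP.n≤1+n d))))
  ... | lo , hi | inj₂ up =
    subst (B x ≤ℤ_) (sym up) (ℤP.≤-trans lo (ℤP.i≤i+j _ 1ℤ)) ,
    subst (_≤ℤ B x + + suc d) (sym up) (ℤP.≤-trans (ℤP.+-monoˡ-≤ 1ℤ hi) (ℤP.≤-reflexive regroup))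
    where
    regroup : B x + + d + 1ℤ ≡ B x + + suc d
    regroup = trans (ℤP.+-assoc (B x) (+ d) 1ℤ) (cong (λ k → B x + + k) (ℕP.+-comm d 1))

  B-mono : ∀ {x y} → 1 ≤ x → x ≤ y → B x ≤ℤ B y
  B-mono {x} {y} 1≤x x≤y =
    subst (λ z → B x ≤ℤ B z) (ℕP.m∸n+n≡m x≤y) (proj₁ (B-increment (y ℕ.∸ x) x 1≤x))

  B-lipschitz : ∀ {x y} d → 1 ≤ x → 1 ≤ y → y ≤ x ℕ.+ d → B y ≤ℤ B x + + d
  B-lipschitz {x} {y} d 1≤x 1≤y y≤x+d =
    ℤP.≤-trans (B-mono 1≤y (subst (y ≤_) (ℕP.+-comm x d) y≤x+d)) (proj₂ (B-increment d x 1≤x))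

-- Position p lies in block K, j places
-- before its end, when p = mK - j with K ≥ 1 and 0 ≤ j < m; the m-interleaving
-- of B takes the value B(K) on block K.  In integer form p = MK + r with the
-- offset r = -j in (-M, 0].
module Blocks (m : ℕ) {{_ : NonZero m}} where

  M : ℤ
  M = + m

  InBlock : ℕ → ℕ → ℕ → Set
  InBlock p K j = 1 ≤ K × j < m × p ℕ.+ j ≡ m ℕ.* K

  block-exists : ∀ p → 1 ≤ p → ∃[ K ] ∃[ j ] InBlock p K j
  block-exists (suc p) _ = suc q , m ℕ.∸ suc r , s≤s z≤n , ℕP.∸-monoʳ-< (s≤s z≤n) r<m , fits
    where
    open ≡-Reasoning
    q r : ℕ
    q = p / m
    r = p % m
    r<m : r < m
    r<m = m%n<n p m
    regroup : ∀ r Q D → suc (r ℕ.+ Q) ℕ.+ D ≡ (suc r ℕ.+ D) ℕ.+ Q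
    regroup = ℕSolver.solve-∀
    fits : suc p ℕ.+ (m ℕ.∸ suc r) ≡ m ℕ.* suc q
    fits = begin
      suc p ℕ.+ (m ℕ.∸ suc r)               ≡⟨ cong (λ x → suc x ℕ.+ (m ℕ.∸ suc r)) (m≡m%n+[m/n]*n p m) ⟩
      suc (r ℕ.+ q ℕ.* m) ℕ.+ (m ℕ.∸ suc r) ≡⟨ regroup r (q ℕ.* m) (m ℕ.∸ suc r) ⟩
      (suc r ℕ.+ (m ℕ.∸ suc r)) ℕ.+ q ℕ.* m ≡⟨ cong (ℕ._+ q ℕ.* m) (ℕP.m+[n∸m]≡n r<m) ⟩
      m ℕ.+ q ℕ.* m                         ≡⟨ cong (m ℕ.+_) (ℕP.*-comm q m) ⟩
      m ℕ.+ m ℕ.* q                         ≡⟨ sym (ℕP.*-suc m q) ⟩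
      m ℕ.* suc q                           ∎

  block-offset : ∀ {p K j} → p ℕ.+ j ≡ m ℕ.* K → + p ≡ M * + K - + j
  block-offset {p} {K} {j} eq = begin
    + p             ≡⟨ add-sub (+ p) (+ j) ⟩
    + p + + j - + j ≡⟨ cong (_- + j) (trans (sym (ℤP.pos-+ p j)) (trans (cong +_ eq) (ℤP.pos-* m K))) ⟩
    M * + K - + j   ∎
    where
    open ≡-Reasoning
    add-sub : ∀ P J → P ≡ P + J - J
    add-sub = solve-∀

  -- The offset -j of a block position lies in (-M, 0], stated in the form
  -- -M·1 < -j ≤ M·0 consumed by block-compare.
  block-offset-bounds : ∀ {j} → j < m → - (M * + 1) <ℤ - + j × - + j ≤ℤ M * + 0
  block-offset-bounds {j} j<m =
    subst (λ x → - x <ℤ - + j) (sym (ℤP.*-identityʳ M)) (ℤP.neg-mono-< (+<+ j<m)) ,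
    subst (- + j ≤ℤ_) (sym (ℤP.*-zeroʳ M)) (ℤP.neg-mono-≤ (+≤+ z≤n))

  -- m ≤ 1·m + x: the side condition of the offset lemmas below when d = 1.
  m≤1*m+ : ∀ x → m ≤ 1 ℕ.* m ℕ.+ x
  m≤1*m+ x = ℕP.≤-trans (ℕP.≤-reflexive (sym (ℕP.*-identityˡ m))) (ℕP.m≤m+n (1 ℕ.* m) x)

  IsOffset : ℤ → Set
  IsOffset r = - (M * + 1) <ℤ r × r ≤ℤ 0ℤ

  block-compare : ∀ {K₁ K₂ r₁ r₂} e f → M * + K₁ + r₁ ≡ M * + K₂ + r₂ →
    - (M * + suc e) <ℤ r₁ → r₂ ≤ℤ M * + f → K₁ ≤ K₂ ℕ.+ (e ℕ.+ f)
  block-compare {K₁} {K₂} {r₁} {r₂} e f eq r₁> r₂≤ =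
    ℕP.≤-pred (ℕP.*-cancelˡ-< m K₁ _
      (ℤP.drop‿+<+ (subst₂ _<ℤ_ (sym (ℤP.pos-* m K₁)) (sym (ℤP.pos-* m _)) below)))
    where
    open ℤP.≤-Reasoning
    add-sub : ∀ X R → X ≡ X + R - R
    add-sub = solve-∀
    collect : ∀ M K F E → M * K + M * F + M * (1ℤ + E) ≡ M * (1ℤ + (K + (E + F)))
    collect = solve-∀
    casts : + (K₂ ℕ.+ (e ℕ.+ f)) ≡ + K₂ + (+ e + + f)
    casts = trans (ℤP.pos-+ K₂ (e ℕ.+ f)) (cong (λ k → + K₂ + k) (ℤP.pos-+ e f))
    below : M * + K₁ <ℤ M * + suc (K₂ ℕ.+ (e ℕ.+ f))
    below = begin-strict
      M * + K₁                          ≡⟨ add-sub (M * + K₁) r₁ ⟩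
      M * + K₁ + r₁ - r₁                ≡⟨ cong (_- r₁) eq ⟩
      M * + K₂ + r₂ - r₁                <⟨ ℤP.+-monoʳ-< (M * + K₂ + r₂) (ℤP.neg-mono-< r₁>) ⟩
      M * + K₂ + r₂ + - - (M * + suc e) ≡⟨ cong (λ k → M * + K₂ + r₂ + k) (ℤP.neg-involutive _) ⟩
      M * + K₂ + r₂ + M * + suc e       ≤⟨ ℤP.+-monoˡ-≤ (M * + suc e) (ℤP.+-monoʳ-≤ (M * + K₂) r₂≤) ⟩
      M * + K₂ + M * + f + M * + suc e  ≡⟨ collect M (+ K₂) (+ f) (+ e) ⟩
      M * (1ℤ + (+ K₂ + (+ e + + f)))   ≡⟨ cong (λ k → M * (1ℤ + k)) (sym casts) ⟩
      M * + suc (K₂ ℕ.+ (e ℕ.+ f))      ∎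

  offset-lower : ∀ {α i j} d → + i - M ≤ℤ α → j < d ℕ.* m ℕ.+ i → - (M * + suc d) <ℤ α - + j
  offset-lower {α} {i} {j} d α≥ j< = begin-strict
    - (M * + suc d)             ≡⟨ trans (split M (+ d) (+ i)) (cong (λ k → + i - M - k) (sym casts)) ⟩
    + i - M - + (d ℕ.* m ℕ.+ i) <⟨ ℤP.+-monoʳ-< (+ i - M) (ℤP.neg-mono-< (+<+ j<)) ⟩
    + i - M - + j               ≤⟨ ℤP.+-monoˡ-≤ (- + j) α≥ ⟩
    α - + j                     ∎
    where
    open ℤP.≤-Reasoning
    split : ∀ M D I → - (M * (1ℤ + D)) ≡ I - M - (D * M + I)
    split = solve-∀
    casts : + (d ℕ.* m ℕ.+ i) ≡ + d * M + + i
    casts = trans (ℤP.pos-+ (d ℕ.* m) i) (cong (_+ + i) (ℤP.pos-* d m))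

  offset-upper : ∀ {α i j} d → α <ℤ + i → i ≤ d ℕ.* m ℕ.+ suc j → α - + j ≤ℤ M * + d
  offset-upper {α} {i} {j} d α< i≤ = begin
    α - + j                              ≤⟨ ℤP.+-monoˡ-≤ (- + j) (ℤP.i<j⇒i≤pred[j] α<) ⟩
    -1ℤ + + i - + j                      ≤⟨ ℤP.+-monoˡ-≤ (- + j) (ℤP.+-monoʳ-≤ -1ℤ (+≤+ i≤)) ⟩
    -1ℤ + + (d ℕ.* m ℕ.+ suc j) - + j    ≡⟨ cong (λ k → -1ℤ + k - + j) casts ⟩
    -1ℤ + (+ d * M + (1ℤ + + j)) - + j   ≡⟨ cancel M (+ d) (+ j) ⟩
    M * + d                              ∎
    where
    open ℤP.≤-Reasoning
    cancel : ∀ M D J → -1ℤ + (D * M + (1ℤ + J)) - J ≡ M * D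
    cancel = solve-∀
    casts : + (d ℕ.* m ℕ.+ suc j) ≡ + d * M + (1ℤ + + j)
    casts = trans (ℤP.pos-+ (d ℕ.* m) (suc j)) (cong (_+ + suc j) (ℤP.pos-* d m))

  sum-offset : ∀ {V S j} → M * V - + j ≤ℤ S × S ≤ℤ M * (V + 1ℤ) - + suc j →
    IsOffset (M * V - + j - S)
  sum-offset {V} {S} {j} (S≥ , S≤) = above , ℤP.i≤j⇒i-j≤0 S≥
    where
    open ℤP.≤-Reasoning
    rewrite-gap : ∀ M V J → 1ℤ + - (M * 1ℤ) ≡ M * V - J - (M * (V + 1ℤ) - (1ℤ + J))
    rewrite-gap = solve-∀
    above : - (M * + 1) <ℤ M * V - + j - S
    above = begin-strict
      - (M * + 1)                               <⟨ ℤP.suc[i]≤j⇒i<j ℤP.≤-refl ⟩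
      1ℤ + - (M * + 1)                          ≡⟨ rewrite-gap M V (+ j) ⟩
      M * V - + j - (M * (V + 1ℤ) - + suc j)    ≤⟨ ℤP.+-monoʳ-≤ (M * V - + j) (ℤP.neg-mono-≤ S≤) ⟩
      M * V - + j - S                           ∎

  block-≤⇒ : ∀ {p K j} c → InBlock p K j → K ≤ c → p ≤ m ℕ.* c
  block-≤⇒ {p} {K} {j} c (_ , _ , eq) K≤c =
    ℕP.≤-trans (ℕP.m≤m+n p j) (subst (ℕ._≤ m ℕ.* c) (sym eq) (ℕP.*-monoʳ-≤ m K≤c))

  block-≤⇐ : ∀ {p K j} c → InBlock p K j → p ≤ m ℕ.* c → K ≤ c
  block-≤⇐ {p} {K} {j} c (_ , j<m , eq) p≤mc = ℕP.≤-pred (ℕP.*-cancelˡ-< m K (suc c) mK<)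
    where
    mK< : m ℕ.* K < m ℕ.* suc c
    mK< = subst₂ _<_ eq (trans (ℕP.+-comm (m ℕ.* c) m) (sym (ℕP.*-suc m c))) (ℕP.+-mono-≤-< p≤mc j<m)

module Agreement (m : ℕ) {{_ : NonZero m}} (B C : ℕ → ℤ)
  (steps : ∀ n → 1 ≤ n → (B (suc n) ≡ B n) ⊎ (B (suc n) ≡ B n + + 1)) where
  open Blocks m
  open SlowGrowth B steps

  Agrees : ℕ → Set
  Agrees p = ∀ K j → InBlock p K j → C p ≡ B K

  module Below (n : ℕ) (IH : ∀ {p} → p < n → Agrees p) where

    bracket-upper : ∀ {p K r} d → 1 ≤ p → p < n → 1 ≤ K →
      + p ≡ M * + K + r → r ≤ℤ M * + d → C p ≤ℤ B K + + d
    bracket-upper {p} {K} d 1≤p p<n 1≤K p≡ r≤ with block-exists p 1≤p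
    ... | K′ , j′ , blk@(1≤K′ , j′<m , eq) =
      subst (_≤ℤ B K + + d) (sym (IH p<n K′ j′ blk)) (B-lipschitz d 1≤K 1≤K′ K′≤K+d)
      where
      K′≤K+d : K′ ≤ K ℕ.+ d
      K′≤K+d = block-compare 0 d (trans (sym (block-offset eq)) p≡) (proj₁ (block-offset-bounds j′<m)) r≤

    bracket-lower : ∀ {p K r} d → 1 ≤ p → p < n → 1 ≤ K →
      + p ≡ M * + K + r → - (M * + suc d) <ℤ r → B K ≤ℤ C p + + d
    bracket-lower {p} {K} d 1≤p p<n 1≤K p≡ r> with block-exists p 1≤p
    ... | K′ , j′ , blk@(1≤K′ , j′<m , eq) =
      subst (λ x → B K ≤ℤ x + + d) (sym (IH p<n K′ j′ blk)) (B-lipschitz d 1≤K′ 1≤K K≤K′+d)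
      where
      K≤K′+d : K ≤ K′ ℕ.+ d
      K≤K′+d = subst (λ e → K ≤ K′ ℕ.+ e) (ℕP.+-identityʳ d)
        (block-compare d 0 (trans (sym p≡) (block-offset eq)) r> (proj₂ (block-offset-bounds j′<m)))

    agree-at : ∀ {p K r} → 1 ≤ p → p < n → 1 ≤ K → + p ≡ M * + K + r → IsOffset r → C p ≡ B K
    agree-at 1≤p p<n 1≤K p≡ (r> , r≤) = ℤP.≤-antisym
      (subst (C _ ≤ℤ_) (ℤP.+-identityʳ _)
        (bracket-upper 0 1≤p p<n 1≤K p≡ (subst (_ ≤ℤ_) (sym (ℤP.*-zeroʳ M)) r≤)))
      (subst (B _ ≤ℤ_) (ℤP.+-identityʳ _) (bracket-lower 0 1≤p p<n 1≤K p≡ r>))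

    module AtPosition (K j : ℕ) (n≡ : + n ≡ M * + K - + j) (j<m : j < m) where

      summand-bounds : ∀ {x α i k} → ValidIx n x → x ≡ M * + k + (α - + j) → 1 ≤ k →
        (+ i - M ≤ℤ α) × (α <ℤ + i) → i ≤ m →
        stepDown (B k) j i ≤ℤ C at x × C at x ≤ℤ stepDown (B k + 1ℤ) (suc j) i
      summand-bounds {x} {α} {i} {k} vx x≡ 1≤k (α≥ , α<) i≤m = lower , upper
        where
        p≡ : + ∣ x ∣ ≡ M * + k + (α - + j)
        p≡ = trans (proj₁ (valid⇒ℕ vx)) x≡
        1≤p : 1 ≤ ∣ x ∣
        1≤p = proj₁ (proj₂ (valid⇒ℕ vx))
        p<n : ∣ x ∣ < n
        p<n = proj₂ (proj₂ (valid⇒ℕ vx))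
        lower : stepDown (B k) j i ≤ℤ C ∣ x ∣
        lower with i ℕ.≤? j
        ... | yes _ = ≤-suc⇒pred-≤
          (bracket-lower 1 1≤p p<n 1≤k p≡ (offset-lower 1 α≥ (ℕP.<-≤-trans j<m (m≤1*m+ i))))
        ... | no i≰j = subst (B k ≤ℤ_) (ℤP.+-identityʳ _)
          (bracket-lower 0 1≤p p<n 1≤k p≡ (offset-lower 0 α≥ (ℕP.≰⇒> i≰j)))
        upper : C ∣ x ∣ ≤ℤ stepDown (B k + 1ℤ) (suc j) i
        upper with i ℕ.≤? suc j
        ... | yes i≤j+1 = subst (C ∣ x ∣ ≤ℤ_) (plus-zero (B k))
          (bracket-upper 0 1≤p p<n 1≤k p≡ (offset-upper 0 α< i≤j+1))
          where
          plus-zero : ∀ V → V + 0ℤ ≡ V + 1ℤ - 1ℤ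
          plus-zero = solve-∀
        ... | no _ = bracket-upper 1 1≤p p<n 1≤k p≡ (offset-upper 1 α< (ℕP.≤-trans i≤m (m≤1*m+ (suc j))))

      -- With V = B(K - a), the inner sum S satisfies
      -- mV - j ≤ S ≤ m(V+1) - (j+1), so n - ms - S = M(K - s - V) + (mV - j - S)
      -- lies in block K - s - V, where C takes the value B(K - s - V).
      recurrence-term : ∀ (s a : ℕ) (α : ℕ → ℤ) →
        (∀ i → 1 ≤ i → i ≤ m → (+ i - M ≤ℤ α i) × (α i <ℤ + i)) →
        ValidIx K (+ K - + a) → ValidIx K (+ K - + s - B at (+ K - + a)) →
        (∀ i → 1 ≤ i → i ≤ m → ValidIx n (+ n - + (m ℕ.* a) + α i)) →
        ValidIx n (+ n - + (m ℕ.* s) - sum1 m (λ i → C at (+ n - + (m ℕ.* a) + α i))) →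
        C at (+ n - + (m ℕ.* s) - sum1 m (λ i → C at (+ n - + (m ℕ.* a) + α i)))
          ≡ B at (+ K - + s - B at (+ K - + a))
      recurrence-term s a α α-bounds vKa vKs vterms vQ =
        agree-at (proj₁ (proj₂ (valid⇒ℕ vQ))) (proj₂ (proj₂ (valid⇒ℕ vQ))) (proj₁ (proj₂ (valid⇒ℕ vKs)))
          Q≡ (sum-offset (sum1-between m V j<m bounds))
        where
        open ≡-Reasoning
        k : ℕ
        k = ∣ + K - + a ∣
        V : ℤ
        V = B k
        S : ℤ
        S = sum1 m (λ i → C at (+ n - + (m ℕ.* a) + α i))
        regroup-term : ∀ M K A J α → M * K - J - M * A + α ≡ M * (K - A) + (α - J)
        regroup-term = solve-∀
        term≡ : ∀ i → + n - + (m ℕ.* a) + α i ≡ M * + k + (α i - + j)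
        term≡ i = begin
          + n - + (m ℕ.* a) + α i              ≡⟨ cong₂ (λ u w → u - w + α i) n≡ (ℤP.pos-* m a) ⟩
          M * + K - + j - M * + a + α i        ≡⟨ regroup-term M (+ K) (+ a) (+ j) (α i) ⟩
          M * (+ K - + a) + (α i - + j)        ≡⟨ cong (λ u → M * u + (α i - + j)) (sym (proj₁ (valid⇒ℕ vKa))) ⟩
          M * + k + (α i - + j)                ∎
        bounds : ∀ i → 1 ≤ i → i ≤ m →
          stepDown V j i ≤ℤ C at (+ n - + (m ℕ.* a) + α i) ×
          C at (+ n - + (m ℕ.* a) + α i) ≤ℤ stepDown (V + 1ℤ) (suc j) i
        bounds i 1≤i i≤m =
          summand-bounds (vterms i 1≤i i≤m) (term≡ i) (proj₁ (proj₂ (valid⇒ℕ vKa))) (α-bounds i 1≤i i≤m) i≤m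
        regroup-outer : ∀ M K Sh V J S → M * K - J - M * Sh - S ≡ M * (K - Sh - V) + (M * V - J - S)
        regroup-outer = solve-∀
        Q≡ : + ∣ + n - + (m ℕ.* s) - S ∣ ≡ M * + ∣ + K - + s - V ∣ + (M * V - + j - S)
        Q≡ = begin
          + ∣ + n - + (m ℕ.* s) - S ∣          ≡⟨ proj₁ (valid⇒ℕ vQ) ⟩
          + n - + (m ℕ.* s) - S                ≡⟨ cong₂ (λ u w → u - w - S) n≡ (ℤP.pos-* m s) ⟩
          M * + K - + j - M * + s - S          ≡⟨ regroup-outer M (+ K) (+ s) V (+ j) S ⟩
          M * (+ K - + s - V) + (M * V - + j - S) ≡⟨ cong (λ u → M * u + (M * V - + j - S)) (sym (proj₁ (valid⇒ℕ vKs))) ⟩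
          M * + ∣ + K - + s - V ∣ + (M * V - + j - S) ∎

  agrees-everywhere : ∀ s t a b c (ξ α β : ℕ → ℤ) → IsSolB s t a b c ξ B → IsSolC m s t a b c α β ξ C →
    (∀ i → 1 ≤ i → i ≤ m → (+ i - M ≤ℤ α i) × (α i <ℤ + i)) →
    (∀ i → 1 ≤ i → i ≤ m → (+ i - M ≤ℤ β i) × (β i <ℤ + i)) →
    ∀ p → Agrees p
  agrees-everywhere s t a b c ξ α β (B-init , B-rec) (C-init , C-rec) α-bounds β-bounds = <-rec Agrees step
    where
    step : ∀ n → (∀ {p} → p < n → Agrees p) → Agrees n
    step n IH K j blk@(1≤K , j<m , eq) with n ℕ.≤? m ℕ.* c
    ... | yes n≤mc = begin
      C n                ≡⟨ cong C (sym (trans (cong (ℕ._∸ j) (sym eq)) (ℕP.m+n∸n≡m n j))) ⟩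
      C (m ℕ.* K ℕ.∸ j)  ≡⟨ C-init K j 1≤K K≤c j<m ⟩
      ξ K                ≡⟨ sym (B-init K 1≤K K≤c) ⟩
      B K                ∎
      where
      open ≡-Reasoning
      K≤c : K ≤ c
      K≤c = block-≤⇐ c blk n≤mc
    ... | no n≰mc with B-rec K (ℕP.≰⇒> (λ K≤c → n≰mc (block-≤⇒ c blk K≤c))) | C-rec n (ℕP.≰⇒> n≰mc)
    ...   | vKa , vKs , vKb , vKt , B≡ | vα , vQs , vβ , vQt , C≡ =
      trans C≡ (trans (cong₂ _+_ (recurrence-term s a α α-bounds vKa vKs vα vQs)
                                 (recurrence-term t b β β-bounds vKb vKt vβ vQt)) (sym B≡))
      where
      open Below n IH
      open AtPosition K j (block-offset eq) j<m

theorem4p4 : (s t a b c : ℕ) → 1 ≤ a → 1 ≤ b → (ξ B : ℕ → ℤ) →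
    IsSolB s t a b c ξ B → SlowlyGrowing B →
    (m : ℕ) → 1 ≤ m → (α β : ℕ → ℤ) →
    (∀ i → 1 ≤ i → i ≤ m → (+ i - + m ≤ℤ α i) × (α i <ℤ + i)) →
    (∀ i → 1 ≤ i → i ≤ m → (+ i - + m ≤ℤ β i) × (β i <ℤ + i)) →
    (C : ℕ → ℤ) → IsSolC m s t a b c α β ξ C →
    Interleaving m B C
theorem4p4 s t a b c _ _ ξ B solB growth m 1≤m α β α-bounds β-bounds C solC N j 1≤N j<m =
  Agreement.agrees-everywhere m {{ℕ.>-nonZero 1≤m}} B C (proj₁ growth)
    s t a b c ξ α β solB solC α-bounds β-bounds (m ℕ.* N ℕ.∸ j) N j (1≤N , j<m , ℕP.m∸n+n≡m j≤mN)
  where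
  j≤mN : j ≤ m ℕ.* N
  j≤mN = ℕP.≤-trans (ℕP.<⇒≤ j<m) (ℕP.m≤m*n m N {{ℕ.>-nonZero 1≤N}})
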